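{- Let $G$ be a nut graph whose vertex set is partitioned into the $\mathrm{Aut}(G)$-orbits $V(G) = \mathcal{V}_1 \sqcup \cdots \sqcup \mathcal{V}_k$, and let $\mathbf{x} = [x_1\ \ldots\ x_n]^\intercal$ be a non-zero vector in $\ker \mathbf{A}(G)$. Suppose there is an orbit $\mathcal{V}_\ell$ such that (i) $\mathcal{V}_\ell$ is a leaf (vertex of degree $1$) in the vertex-orbit graph $\mathfrak{G}(G)$, and (ii) $\mathcal{V}_\ell$ is an independent set in $G$. Then for every orbit $\mathcal{V}_i$ we have $\sum_{j \in \mathcal{V}_i} x_j = 0$; moreover, for every orbit $\mathcal{V}_i$, $|\{ j \in \mathcal{V}_i : x_j > 0 \}| = |\{ j \in \mathcal{V}_i : x_j < 0 \}|$, and $|\mathcal{V}_i|$ is even.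
   Context: All graphs are finite, simple and connected. A nut graph is a graph $G$ whose adjacency matrix $\mathbf{A}(G)$ has one-dimensional kernel spanned by a vector with no zero entry ($K_1$ excluded as trivial). $\mathrm{Aut}(G)$ is the full automorphism group. The vertex-orbit graph $\mathfrak{G}(G)$ is the simple graph whose vertices are the vertex orbits $\mathcal{V}_1,\dots,\mathcal{V}_k$ of $\mathrm{Aut}(G)$, with $\mathcal{V}_i$ and $\mathcal{V}_j$ ($i\neq j$) adjacent iff $G$ has at least one edge with one endvertex in $\mathcal{V}_i$ and the other in $\mathcal{V}_j$.
   Formalization: The vector $\mathbf{x}$ has rational entries, and the kernel of $\mathbf{A}(G)$ in the definition of a nut graph is taken over ℚ. -}

module Defs where

open import Data.Nat using (ℕ; zero; suc; _≤_)
open import Data.Fin using (Fin)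
open import Data.Fin.Permutation using (Permutation′; _⟨$⟩ʳ_)
open import Data.Bool using (Bool; true; false; if_then_else_)
open import Data.List using (List; []; _∷_; foldr; map; allFin; filter; length)
open import Data.List.Membership.Propositional using (_∈_)
open import Data.List.Relation.Unary.Unique.Propositional using (Unique)
open import Data.Rational using (ℚ; 0ℚ; _+_; _*_; _<_; _<?_)
open import Data.Product using (Σ; ∃; ∃-syntax; _×_; _,_)
open import Relation.Binary.PropositionalEquality using (_≡_; _≢_)
open import Relation.Nullary using (¬_)
open import Function.Bundles using (_⇔_)

record SimpleGraph (n : ℕ) : Set where
  field
    adj   : Fin n → Fin n → Bool
    sym   : ∀ i j → adj i j ≡ adj j i
    irrefl : ∀ i → adj i i ≡ false

open SimpleGraph public

data Walk {n : ℕ} (G : SimpleGraph n) : Fin n → Fin n → Set where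
  here : ∀ {u} → Walk G u u
  step : ∀ {u v w} → adj G u v ≡ true → Walk G v w → Walk G u w

Connected : {n : ℕ} → SimpleGraph n → Set
Connected G = ∀ u v → Walk G u v

sumℚ : List ℚ → ℚ
sumℚ = foldr _+_ 0ℚ

adjMul : {n : ℕ} → SimpleGraph n → (Fin n → ℚ) → Fin n → ℚ
adjMul {n} G x i = sumℚ (map (λ j → if adj G i j then x j else 0ℚ) (allFin n))

InKernel : {n : ℕ} → SimpleGraph n → (Fin n → ℚ) → Set
InKernel G x = ∀ i → adjMul G x i ≡ 0ℚ

IsNutGraph : {n : ℕ} → SimpleGraph n → Set
IsNutGraph {n} G =
  2 ≤ n × Connected G ×
  Σ (Fin n → ℚ) λ z →
    InKernel G z × (∀ i → z i ≢ 0ℚ) ×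
    (∀ y → InKernel G y → ∃[ c ] (∀ i → y i ≡ c * z i))

IsAutomorphism : {n : ℕ} → SimpleGraph n → Permutation′ n → Set
IsAutomorphism G σ = ∀ i j → adj G (σ ⟨$⟩ʳ i) (σ ⟨$⟩ʳ j) ≡ adj G i j

SameOrbit : {n : ℕ} → SimpleGraph n → Fin n → Fin n → Set
SameOrbit {n} G u v = Σ (Permutation′ n) λ σ → IsAutomorphism G σ × σ ⟨$⟩ʳ u ≡ v

OrbitAdj : {n : ℕ} → SimpleGraph n → Fin n → Fin n → Set
OrbitAdj G u v =
  ¬ SameOrbit G u v ×
  ∃[ a ] ∃[ b ] (SameOrbit G u a × SameOrbit G v b × adj G a b ≡ true)

OrbitLeaf : {n : ℕ} → SimpleGraph n → Fin n → Set
OrbitLeaf G ℓ =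
  ∃[ m ] (OrbitAdj G ℓ m × (∀ m′ → OrbitAdj G ℓ m′ → SameOrbit G m m′))

OrbitIndependent : {n : ℕ} → SimpleGraph n → Fin n → Set
OrbitIndependent G ℓ =
  ∀ a b → SameOrbit G ℓ a → SameOrbit G ℓ b → adj G a b ≡ false

EnumeratesOrbit : {n : ℕ} → SimpleGraph n → Fin n → List (Fin n) → Set
EnumeratesOrbit G v L = Unique L × (∀ j → (j ∈ L ⇔ SameOrbit G v j))

countPos : {n : ℕ} → (Fin n → ℚ) → List (Fin n) → ℕ
countPos x L = length (filter (λ j → 0ℚ <? x j) L)

countNeg : {n : ℕ} → (Fin n → ℚ) → List (Fin n) → ℕ
countNeg x L = length (filter (λ j → x j <? 0ℚ) L)

{-# OPTIONS --safe #-}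
module Submission where

-- Let a ∈ 𝒱ℓ and b ∈ 𝒱m be adjacent, where 𝒱m is the unique orbit adjacent to 𝒱ℓ.  The
-- kernel equation at a, multiplied by x_b, contains the positive term x_b², so a has a
-- neighbour j with x_j x_b < 0.  As 𝒱ℓ is independent, j lies in 𝒱m, so some automorphism σ
-- maps b to j.  Since the kernel is one-dimensional, x ∘ σ = c x, and x_j x_b = c x_b² < 0
-- forces c < 0.  Thus σ permutes every orbit while reversing the sign of every entry of the
-- nowhere-zero vector x: each orbit sum S satisfies S = c S, hence S = 0, and σ maps the
-- positive entries of an orbit bijectively onto its negative ones.

open import Defs
open import Data.Nat using (ℕ; _*_)
open import Data.Fin using (Fin)
open import Data.List using (List; map; length)
open import Data.Rational using (ℚ; 0ℚ)
open import Data.Product using (∃; ∃-syntax; _×_)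
open import Relation.Binary.PropositionalEquality using (_≡_; _≢_)

import Data.Nat as ℕ
import Data.Nat.Properties as ℕ
open import Data.Bool using (true; false; if_then_else_)
open import Data.Fin.Permutation using (Permutation′; _⟨$⟩ʳ_; _⟨$⟩ˡ_; inverseˡ; inverseʳ; id; flip; _∘ₚ_)
open import Data.List using ([]; _∷_; allFin; filter)
open import Data.List.Properties using (map-∘; map-cong)
open import Data.List.Membership.Propositional using (_∈_; lose)
open import Data.List.Membership.Propositional.Properties using (∈-map⁺; ∈-map⁻; ∈-allFin)
open import Data.List.Membership.Propositional.Properties.WithK using (unique∧set⇒bag)
open import Data.List.Relation.Unary.Any using (Any; here; there; any?; satisfied)
import Data.List.Relation.Unary.Any.Properties as Any
open import Data.List.Relation.Unary.All as All using (All; _∷_)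
open import Data.List.Relation.Unary.All.Properties using (¬Any⇒All¬)
open import Data.List.Relation.Unary.Unique.Propositional using (Unique)
import Data.List.Relation.Unary.Unique.Propositional.Properties as Unique
open import Data.List.Relation.Binary.BagAndSetEquality using (∼bag⇒↭)
open import Data.List.Relation.Binary.Permutation.Propositional using (_↭_; ↭⇒↭ₛ)
open import Data.List.Relation.Binary.Permutation.Propositional.Properties using (↭-length; filter-↭)
import Data.List.Relation.Binary.Permutation.Propositional.Properties as ↭
import Data.List.Relation.Binary.Permutation.Setoid.Properties as ↭ₛ
open import Data.Rational using (_+_; _<_; _≤_; _<?_; 1/_; 1ℚ; ≢-nonZero; positive; negative)
  renaming (_*_ to _·_)
open import Data.Rational.Properties
open import Data.Product using (_,_)
open import Data.Sum using (_⊎_; inj₁; inj₂)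
open import Function using (_∘_)
open import Function.Bundles using (_⇔_; mk⇔; Equivalence; Injection)
open import Function.Properties.Inverse using (↔⇒↣)
open import Relation.Unary using (Decidable)
open import Relation.Nullary using (¬_; yes; no; contradiction)
open import Relation.Binary.Definitions using (tri<; tri≈; tri>)
open import Relation.Binary.PropositionalEquality
  using (refl; trans; cong; cong₂; subst; setoid; ≢-sym; module ≡-Reasoning)
import Relation.Binary.PropositionalEquality as ≡

private
  variable
    A B : Set
    n : ℕ
    p q c s : ℚ

nonZero⇒pos⊎neg : p ≢ 0ℚ → 0ℚ < p ⊎ p < 0ℚ
nonZero⇒pos⊎neg {p} p≢0 with <-cmp p 0ℚ
... | tri< p<0 _ _ = inj₂ p<0
... | tri≈ _ p≡0 _ = contradiction p≡0 p≢0
... | tri> _ _ p>0 = inj₁ p>0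

*-nonZero : p ≢ 0ℚ → q ≢ 0ℚ → p · q ≢ 0ℚ
*-nonZero {p} {q} p≢0 q≢0 pq≡0 = q≢0 (begin
    q                  ≡⟨ ≡.sym (*-identityˡ q) ⟩
    1ℚ · q             ≡⟨ cong (_· q) (≡.sym (*-inverseˡ p)) ⟩
    ((1/ p) · p) · q   ≡⟨ *-assoc (1/ p) p q ⟩
    (1/ p) · (p · q)   ≡⟨ cong ((1/ p) ·_) pq≡0 ⟩
    (1/ p) · 0ℚ        ≡⟨ *-zeroʳ (1/ p) ⟩
    0ℚ                 ∎)
  where
    open ≡-Reasoning
    instance _ = ≢-nonZero p≢0

*-lcomm : ∀ p q r → p · (q · r) ≡ q · (p · r)
*-lcomm p q r = begin
    p · (q · r)  ≡⟨ ≡.sym (*-assoc p q r) ⟩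
    (p · q) · r  ≡⟨ cong (_· r) (*-comm p q) ⟩
    (q · p) · r  ≡⟨ *-assoc q p r ⟩
    q · (p · r)  ∎
  where open ≡-Reasoning

square-pos : p ≢ 0ℚ → 0ℚ < p · p
square-pos {p} p≢0 with nonZero⇒pos⊎neg p≢0
... | inj₁ p>0 = positive⁻¹ _ {{pos*pos⇒pos p {{positive p>0}} p {{positive p>0}}}}
... | inj₂ p<0 = positive⁻¹ _ {{neg*neg⇒pos p {{negative p<0}} p {{negative p<0}}}}

*-square-neg⇒neg : p ≢ 0ℚ → c · (p · p) < 0ℚ → c < 0ℚ
*-square-neg⇒neg {p} {c} p≢0 c·pp<0 =
  *-cancelʳ-<-nonNeg (p · p) {{pos⇒nonNeg (p · p) {{positive (square-pos p≢0)}}}} {c} {0ℚ}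
    (subst (c · (p · p) <_) (≡.sym (*-zeroˡ (p · p))) c·pp<0)

module _ (c<0 : c < 0ℚ) where

  neg*pos<0 : 0ℚ < p → c · p < 0ℚ
  neg*pos<0 {p} p>0 = negative⁻¹ _ {{neg*pos⇒neg c {{negative c<0}} p {{positive p>0}}}}

  neg*neg>0 : p < 0ℚ → 0ℚ < c · p
  neg*neg>0 {p} p<0 = positive⁻¹ _ {{neg*neg⇒pos c {{negative c<0}} p {{negative p<0}}}}

  neg*>0⇒<0 : 0ℚ < c · p → p < 0ℚ
  neg*>0⇒<0 {p} c·p>0 =
    *-cancelˡ-<-nonPos c {{neg⇒nonPos c {{negative c<0}}}}
      (subst (_< c · p) (≡.sym (*-zeroʳ c)) c·p>0)

  fixed-by-neg⇒0 : s ≡ c · s → s ≡ 0ℚ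
  fixed-by-neg⇒0 {s} s≡c·s with <-cmp s 0ℚ
  ... | tri< s<0 _ _ = contradiction (subst (0ℚ <_) (≡.sym s≡c·s) (neg*neg>0 s<0)) (<-asym s<0)
  ... | tri≈ _ s≡0 _ = s≡0
  ... | tri> _ _ s>0 = contradiction (subst (_< 0ℚ) (≡.sym s≡c·s) (neg*pos<0 s>0)) (<-asym s>0)

sumℚ-↭ : {xs ys : List ℚ} → xs ↭ ys → sumℚ xs ≡ sumℚ ys
sumℚ-↭ = ↭ₛ.foldr-commMonoid (setoid ℚ) +-0-isCommutativeMonoid ∘ ↭⇒↭ₛ

sumℚ-*ˡ : ∀ c xs → sumℚ (map (c ·_) xs) ≡ c · sumℚ xs
sumℚ-*ˡ c []       = ≡.sym (*-zeroʳ c)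
sumℚ-*ˡ c (x ∷ xs) = trans (cong (c · x +_) (sumℚ-*ˡ c xs)) (≡.sym (*-distribˡ-+ c x (sumℚ xs)))

sumℚ-nonNeg : {xs : List ℚ} → All (0ℚ ≤_) xs → 0ℚ ≤ sumℚ xs
sumℚ-nonNeg All.[] = ≤-refl
sumℚ-nonNeg {x ∷ xs} (x≥0 ∷ xs≥0) =
  subst (_≤ x + sumℚ xs) (+-identityˡ 0ℚ) (+-mono-≤ x≥0 (sumℚ-nonNeg xs≥0))

sumℚ-pos : {xs : List ℚ} → All (0ℚ ≤_) xs → Any (0ℚ <_) xs → 0ℚ < sumℚ xs
sumℚ-pos {x ∷ xs} (x≥0 ∷ xs≥0) x∨xs>0 = subst (_< x + sumℚ xs) (+-identityˡ 0ℚ) (split x∨xs>0)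
  where
    split : Any (0ℚ <_) (x ∷ xs) → 0ℚ + 0ℚ < x + sumℚ xs
    split (here x>0)   = +-mono-<-≤ x>0 (sumℚ-nonNeg xs≥0)
    split (there xs>0) = +-mono-≤-< x≥0 (sumℚ-pos xs≥0 xs>0)

sumℚ≡0∧pos⇒neg : {xs : List ℚ} → sumℚ xs ≡ 0ℚ → Any (0ℚ <_) xs → Any (_< 0ℚ) xs
sumℚ≡0∧pos⇒neg {xs} sum≡0 pos with any? (_<? 0ℚ) xs
... | yes neg = neg
... | no ¬neg = contradiction sum≡0 (≢-sym (<⇒≢ (sumℚ-pos (All.map ≮⇒≥ (¬Any⇒All¬ xs ¬neg)) pos)))

unique-set⇒↭ : {xs ys : List A} → Unique xs → Unique ys → (∀ {a} → a ∈ xs ⇔ a ∈ ys) → xs ↭ ys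
unique-set⇒↭ xs! ys! xs≈ys = ∼bag⇒↭ (unique∧set⇒bag xs! ys! xs≈ys)

map-permutation-↭ : (σ : Permutation′ n) {xs : List (Fin n)} → Unique xs →
  (∀ {j} → j ∈ xs → σ ⟨$⟩ʳ j ∈ xs) → (∀ {j} → j ∈ xs → σ ⟨$⟩ˡ j ∈ xs) →
  map (σ ⟨$⟩ʳ_) xs ↭ xs
map-permutation-↭ σ {xs} xs! closedʳ closedˡ =
  unique-set⇒↭ (Unique.map⁺ (Injection.injective (↔⇒↣ σ)) xs!) xs! (mk⇔ to from)
  where
    to : ∀ {a} → a ∈ map (σ ⟨$⟩ʳ_) xs → a ∈ xs
    to a∈σxs with ∈-map⁻ (σ ⟨$⟩ʳ_) a∈σxs
    ... | j , j∈xs , refl = closedʳ j∈xs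
    from : ∀ {a} → a ∈ xs → a ∈ map (σ ⟨$⟩ʳ_) xs
    from a∈xs = subst (_∈ map (σ ⟨$⟩ʳ_) xs) (inverseʳ σ) (∈-map⁺ (σ ⟨$⟩ʳ_) (closedˡ a∈xs))

sumℚ-permute : (σ : Permutation′ n) (h : Fin n → ℚ) →
  sumℚ (map (h ∘ (σ ⟨$⟩ʳ_)) (allFin n)) ≡ sumℚ (map h (allFin n))
sumℚ-permute {n} σ h = trans (cong sumℚ (map-∘ (allFin n)))
  (sumℚ-↭ (↭.map⁺ h (map-permutation-↭ σ (Unique.allFin⁺ n) (λ _ → ∈-allFin _) (λ _ → ∈-allFin _))))

length-filter-map : {P : B → Set} {Q : A → Set} (P? : Decidable P) (Q? : Decidable Q) (f : A → B) →
  (∀ a → P (f a) ⇔ Q a) → ∀ xs → length (filter P? (map f xs)) ≡ length (filter Q? xs)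
length-filter-map P? Q? f P∘f⇔Q [] = refl
length-filter-map P? Q? f P∘f⇔Q (a ∷ xs) with P? (f a) | Q? a
... | yes _  | yes _ = cong ℕ.suc (length-filter-map P? Q? f P∘f⇔Q xs)
... | no _   | no _  = length-filter-map P? Q? f P∘f⇔Q xs
... | yes p  | no ¬q = contradiction (Equivalence.to (P∘f⇔Q a) p) ¬q
... | no ¬p  | yes q = contradiction (Equivalence.from (P∘f⇔Q a) q) ¬p

length≡filter+filter : {P Q : A → Set} (P? : Decidable P) (Q? : Decidable Q) →
  (∀ a → P a ⊎ Q a) → (∀ a → P a → ¬ Q a) →
  ∀ xs → length xs ≡ length (filter P? xs) ℕ.+ length (filter Q? xs)
length≡filter+filter P? Q? P∪Q P∩Q=∅ [] = refl
length≡filter+filter P? Q? P∪Q P∩Q=∅ (a ∷ xs) with P? a | Q? a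
... | yes p | yes q = contradiction q (P∩Q=∅ a p)
... | yes _ | no _  = cong ℕ.suc (length≡filter+filter P? Q? P∪Q P∩Q=∅ xs)
... | no _  | yes _ = trans (cong ℕ.suc (length≡filter+filter P? Q? P∪Q P∩Q=∅ xs))
                        (≡.sym (ℕ.+-suc (length (filter P? xs)) (length (filter Q? xs))))
... | no ¬p | no ¬q with P∪Q a
...   | inj₁ p = contradiction p ¬p
...   | inj₂ q = contradiction q ¬q

module SignReversing {x : A → ℚ} (x≢0 : ∀ a → x a ≢ 0ℚ) {f : A → A} {c : ℚ} (c<0 : c < 0ℚ)
  (x∘f≡c·x : ∀ a → x (f a) ≡ c · x a) {xs : List A} (f[xs]↭xs : map f xs ↭ xs) where

  sum≡0 : sumℚ (map x xs) ≡ 0ℚ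
  sum≡0 = fixed-by-neg⇒0 c<0 (begin
      sumℚ (map x xs)               ≡⟨ sumℚ-↭ (↭.map⁺ x f[xs]↭xs) ⟨
      sumℚ (map x (map f xs))       ≡⟨ cong sumℚ (map-∘ xs) ⟨
      sumℚ (map (x ∘ f) xs)         ≡⟨ cong sumℚ (map-cong x∘f≡c·x xs) ⟩
      sumℚ (map ((c ·_) ∘ x) xs)    ≡⟨ cong sumℚ (map-∘ xs) ⟩
      sumℚ (map (c ·_) (map x xs))  ≡⟨ sumℚ-*ˡ c (map x xs) ⟩
      c · sumℚ (map x xs)           ∎)
    where open ≡-Reasoning

  countPos≡countNeg : length (filter (λ a → 0ℚ <? x a) xs) ≡ length (filter (λ a → x a <? 0ℚ) xs)
  countPos≡countNeg = trans
    (≡.sym (↭-length (filter-↭ (λ a → 0ℚ <? x a) f[xs]↭xs)))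
    (length-filter-map (λ a → 0ℚ <? x a) (λ a → x a <? 0ℚ) f
      (λ a → mk⇔ (λ x[fa]>0 → neg*>0⇒<0 c<0 (subst (0ℚ <_) (x∘f≡c·x a) x[fa]>0))
                 (λ xa<0 → subst (0ℚ <_) (≡.sym (x∘f≡c·x a)) (neg*neg>0 c<0 xa<0)))
      xs)

  length-even : ∃[ k ] (length xs ≡ 2 * k)
  length-even = k , (begin
      length xs        ≡⟨ length≡filter+filter (λ a → 0ℚ <? x a) (λ a → x a <? 0ℚ)
                            (nonZero⇒pos⊎neg ∘ x≢0) (λ _ → <-asym) xs ⟩
      k ℕ.+ negatives  ≡⟨ cong (k ℕ.+_) countPos≡countNeg ⟨
      k ℕ.+ k          ≡⟨ cong (k ℕ.+_) (ℕ.+-identityʳ k) ⟨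
      2 * k            ∎)
    where
      open ≡-Reasoning
      k = length (filter (λ a → 0ℚ <? x a) xs)
      negatives = length (filter (λ a → x a <? 0ℚ) xs)

module _ (G : SimpleGraph n) where

  automorphism⁻¹ : (σ : Permutation′ n) → IsAutomorphism G σ → IsAutomorphism G (flip σ)
  automorphism⁻¹ σ σ-aut i j = begin
      adj G (σ ⟨$⟩ˡ i) (σ ⟨$⟩ˡ j)                      ≡⟨ σ-aut (σ ⟨$⟩ˡ i) (σ ⟨$⟩ˡ j) ⟨
      adj G (σ ⟨$⟩ʳ (σ ⟨$⟩ˡ i)) (σ ⟨$⟩ʳ (σ ⟨$⟩ˡ j))  ≡⟨ cong₂ (adj G) (inverseʳ σ) (inverseʳ σ) ⟩
      adj G i j                                        ∎
    where open ≡-Reasoning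

  sameOrbit-refl : ∀ u → SameOrbit G u u
  sameOrbit-refl u = id , (λ _ _ → refl) , refl

  sameOrbit-sym : ∀ {u v} → SameOrbit G u v → SameOrbit G v u
  sameOrbit-sym (σ , σ-aut , refl) = flip σ , automorphism⁻¹ σ σ-aut , inverseˡ σ

  sameOrbit-trans : ∀ {u v w} → SameOrbit G u v → SameOrbit G v w → SameOrbit G u w
  sameOrbit-trans (σ , σ-aut , refl) (τ , τ-aut , refl) =
    σ ∘ₚ τ , (λ i j → trans (τ-aut (σ ⟨$⟩ʳ i) (σ ⟨$⟩ʳ j)) (σ-aut i j)) , refl

  automorphism-permutes-orbit : (σ : Permutation′ n) → IsAutomorphism G σ →
    ∀ {v L} → EnumeratesOrbit G v L → map (σ ⟨$⟩ʳ_) L ↭ L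
  automorphism-permutes-orbit σ σ-aut (L! , ∈L⇔orbit) = map-permutation-↭ σ L!
    (λ j∈L → ∈L.from (sameOrbit-trans (∈L.to j∈L) (σ , σ-aut , refl)))
    (λ j∈L → ∈L.from (sameOrbit-trans (∈L.to j∈L) (flip σ , automorphism⁻¹ σ σ-aut , refl)))
    where
      module ∈L {j} = Equivalence (∈L⇔orbit j)

  inKernel-∘-automorphism : (σ : Permutation′ n) → IsAutomorphism G σ →
    {x : Fin n → ℚ} → InKernel G x → InKernel G (x ∘ (σ ⟨$⟩ʳ_))
  inKernel-∘-automorphism σ σ-aut {x} x∈ker i = begin
      sumℚ (map (λ j → if adj G i j then x (σ ⟨$⟩ʳ j) else 0ℚ) (allFin n))
        ≡⟨ cong sumℚ (map-cong (λ j → cong (λ e → if e then x (σ ⟨$⟩ʳ j) else 0ℚ) (≡.sym (σ-aut i j))) (allFin n)) ⟩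
      sumℚ (map (λ j → if adj G (σ ⟨$⟩ʳ i) (σ ⟨$⟩ʳ j) then x (σ ⟨$⟩ʳ j) else 0ℚ) (allFin n))
        ≡⟨ sumℚ-permute σ (λ j → if adj G (σ ⟨$⟩ʳ i) j then x j else 0ℚ) ⟩
      adjMul G x (σ ⟨$⟩ʳ i)
        ≡⟨ x∈ker (σ ⟨$⟩ʳ i) ⟩
      0ℚ ∎
    where open ≡-Reasoning

  inKernel⇒opposite-sign-neighbour : {x : Fin n → ℚ} → InKernel G x →
    ∀ {a b} → adj G a b ≡ true → x b ≢ 0ℚ → ∃[ j ] (adj G a j ≡ true × x b · x j < 0ℚ)
  inKernel⇒opposite-sign-neighbour {x} x∈ker {a} {b} a~b xb≢0 =
    neighbour (satisfied (Any.map⁻ (Any.map⁻ (sumℚ≡0∧pos⇒neg terms-sum≡0 b-term-pos))))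
    where
      row : Fin n → ℚ
      row j = if adj G a j then x j else 0ℚ
      terms : List ℚ
      terms = map (x b ·_) (map row (allFin n))
      terms-sum≡0 : sumℚ terms ≡ 0ℚ
      terms-sum≡0 = trans (sumℚ-*ˡ (x b) (map row (allFin n)))
        (trans (cong (x b ·_) (x∈ker a)) (*-zeroʳ (x b)))
      b-term>0 : 0ℚ < x b · row b
      b-term>0 rewrite a~b = square-pos xb≢0
      b-term-pos : Any (0ℚ <_) terms
      b-term-pos = Any.map⁺ (Any.map⁺ (lose (∈-allFin b) b-term>0))
      neighbour : ∃ (λ j → x b · row j < 0ℚ) → ∃[ j ] (adj G a j ≡ true × x b · x j < 0ℚ)
      neighbour (j , term<0) with adj G a j in a~j
      ... | true  = j , a~j , term<0
      ... | false = contradiction (subst (_< 0ℚ) (*-zeroʳ (x b)) term<0) (<-irrefl refl)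

  nut-kernel-nowhereZero : IsNutGraph G → {x : Fin n → ℚ} → InKernel G x →
    ∃[ i ] (x i ≢ 0ℚ) → ∀ i → x i ≢ 0ℚ
  nut-kernel-nowhereZero (_ , _ , z , _ , z≢0 , z-spans) {x} x∈ker (i₀ , xi₀≢0) i xi≡0
    with z-spans x x∈ker
  ... | d , x≡d·z = *-nonZero d≢0 (z≢0 i) (trans (≡.sym (x≡d·z i)) xi≡0)
    where
      d≢0 : d ≢ 0ℚ
      d≢0 d≡0 = xi₀≢0 (trans (x≡d·z i₀) (trans (cong (_· z i₀) d≡0) (*-zeroˡ (z i₀))))

  nut-automorphism-scales-kernel : IsNutGraph G → (σ : Permutation′ n) → IsAutomorphism G σ →
    {x : Fin n → ℚ} → InKernel G x → ∃[ c ] (∀ i → x (σ ⟨$⟩ʳ i) ≡ c · x i)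
  nut-automorphism-scales-kernel (_ , _ , z , z∈ker , _ , z-spans) σ σ-aut {x} x∈ker
    with z-spans x x∈ker | z-spans (z ∘ (σ ⟨$⟩ʳ_)) (inKernel-∘-automorphism σ σ-aut z∈ker)
  ... | d , x≡d·z | c , z∘σ≡c·z = c , λ i → begin
      x (σ ⟨$⟩ʳ i)       ≡⟨ x≡d·z (σ ⟨$⟩ʳ i) ⟩
      d · z (σ ⟨$⟩ʳ i)   ≡⟨ cong (d ·_) (z∘σ≡c·z i) ⟩
      d · (c · z i)      ≡⟨ *-lcomm d c (z i) ⟩
      c · (d · z i)      ≡⟨ cong (c ·_) (x≡d·z i) ⟨
      c · x i            ∎
    where open ≡-Reasoning

  leaf-neighbours-sameOrbit : ∀ {ℓ} → OrbitLeaf G ℓ → OrbitIndependent G ℓ →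
    ∀ {a b a′ b′} → SameOrbit G ℓ a → adj G a b ≡ true → SameOrbit G ℓ a′ → adj G a′ b′ ≡ true →
    SameOrbit G b b′
  leaf-neighbours-sameOrbit {ℓ} (m , _ , leaf) indep ℓ∼a a~b ℓ∼a′ a′~b′ =
    sameOrbit-trans (sameOrbit-sym (m∼ ℓ∼a a~b)) (m∼ ℓ∼a′ a′~b′)
    where
      m∼ : ∀ {a b} → SameOrbit G ℓ a → adj G a b ≡ true → SameOrbit G m b
      m∼ {a} {b} ℓ∼a a~b = leaf b (b∉𝒱ℓ , a , b , ℓ∼a , sameOrbit-refl b , a~b)
        where
          b∉𝒱ℓ : ¬ SameOrbit G ℓ b
          b∉𝒱ℓ ℓ∼b with trans (≡.sym a~b) (indep a b ℓ∼a ℓ∼b)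
          ... | ()

  nut-leaf⇒sign-reversing-automorphism : IsNutGraph G → {x : Fin n → ℚ} → InKernel G x →
    (∀ i → x i ≢ 0ℚ) → ∀ {ℓ} → OrbitLeaf G ℓ → OrbitIndependent G ℓ →
    ∃[ σ ] (IsAutomorphism G σ × ∃[ c ] (c < 0ℚ × (∀ i → x (σ ⟨$⟩ʳ i) ≡ c · x i)))
  nut-leaf⇒sign-reversing-automorphism nut {x} x∈ker x≢0 leaf@(_ , (_ , a , b , ℓ∼a , _ , a~b) , _) indep
    with inKernel⇒opposite-sign-neighbour x∈ker a~b (x≢0 b)
  ... | j , a~j , xb·xj<0
    with leaf-neighbours-sameOrbit leaf indep ℓ∼a a~b ℓ∼a a~j
  ... | σ , σ-aut , refl
    with nut-automorphism-scales-kernel nut σ σ-aut x∈ker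
  ... | c , x∘σ≡c·x = σ , σ-aut , c , *-square-neg⇒neg (x≢0 b) c·xb²<0 , x∘σ≡c·x
    where
      c·xb²<0 : c · (x b · x b) < 0ℚ
      c·xb²<0 = subst (_< 0ℚ) (trans (cong (x b ·_) (x∘σ≡c·x b)) (*-lcomm (x b) c (x b))) xb·xj<0

lemma7 : {n : ℕ} (G : SimpleGraph n) → IsNutGraph G →
    (x : Fin n → ℚ) → InKernel G x → (∃[ i ] (x i ≢ 0ℚ)) →
    (ℓ : Fin n) → OrbitLeaf G ℓ → OrbitIndependent G ℓ →
    (v : Fin n) (L : List (Fin n)) → EnumeratesOrbit G v L →
      (sumℚ (map x L) ≡ 0ℚ) ×
      (countPos x L ≡ countNeg x L) ×
      (∃[ k ] (length L ≡ 2 * k))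
lemma7 G nut x x∈ker some-x≢0 _ leaf indep _ _ L-enum =
  let x≢0 = nut-kernel-nowhereZero G nut x∈ker some-x≢0
      (σ , σ-aut , c , c<0 , x∘σ≡c·x) = nut-leaf⇒sign-reversing-automorphism G nut x∈ker x≢0 leaf indep
      open SignReversing x≢0 c<0 x∘σ≡c·x (automorphism-permutes-orbit G σ σ-aut L-enum)
  in sum≡0 , countPos≡countNeg , length-even
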